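{- With the notation of the context: (i) for every integer $i$, $X_i=\mathbf{AB}$ implies $X_{i+1}=\mathbf{0}$; (ii) for every integer $i$, $X_{i+1}=\mathbf{0}$ implies $X_i\in\{\mathbf{0},\mathbf{AB}\}$.
   Context: Let $p$ be a prime, $f\ge2$, $q=p^f$, $e=p^f-1$, $\nu=p+p^2+\dots+p^{f-1}$. Let $h$ be an integer with $0\le h\le p^{2f}-2$ not divisible by $q+1$, and $\gamma'\in\mathbb{Z}/e\mathbb{Z}$. Let $h_0,\dots,h_{f-1}\in[\![0,p-1]\!]$ be the unique integers with $h\equiv1+\sum_{i=0}^{f-1}h_ip^{f-1-i}\pmod{q+1}$; set $h_i=p-1-h_{i-f}$ for $f\le i\le2f-1$ and extend $(h_i)$ to $\mathbb{Z}$ by $2f$-periodicity. Let $\varepsilon_i=1$ if $h_i=p-1$ and $0$ otherwise. For $i\ge0$ let $\alpha_i\in[\![0,e-1]\!]$ with $\alpha_i\equiv\lfloor p^ih/(q+1)\rfloor-p^i\gamma'\pmod e$, extended $2f$-periodically to $\mathbb{Z}$. Define $X_i=\mathbf{A}$ if $0\le\alpha_i<\nu/p+\varepsilon_{i+f}$; $\mathbf{AB}$ if $\nu/p+\varepsilon_{i+f}\le\alpha_i\le\frac{p-1}{p}\nu-\varepsilon_i$; $\mathbf{B}$ if $\frac{p-1}{p}\nu-\varepsilon_i<\alpha_i\le\nu$; $\mathbf{0}$ if $\nu<\alpha_i<e$. -}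

module Defs where

open import Data.Nat as ℕ using (ℕ; zero; suc; _+_; _*_; _∸_; _^_; _≤_; _<_; _<?_; _≡ᵇ_)
open import Data.Nat.DivMod using (_/_)
open import Data.Integer as ℤ using (ℤ; +_)
open import Data.Integer.DivMod using (_%ℕ_)
open import Data.List using (map; upTo; drop)
open import Data.Nat.ListAction using (sum)
open import Relation.Binary.PropositionalEquality using (_≡_)
open import Data.Product using (_×_)
open import Data.Bool using (if_then_else_)
open import Relation.Nullary using (yes; no)

-- x mod n in [0, n-1] for x : ℤ (junk value 0 when n = 0; never used
-- in that case since all moduli below are ≥ 2 under the hypotheses)
modℤ : ℤ → ℕ → ℕ
modℤ x zero    = 0
modℤ x (suc n) = x %ℕ suc n

q : ℕ → ℕ → ℕ
q p f = p ^ f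

e : ℕ → ℕ → ℕ
e p f = p ^ f ∸ 1

ν : ℕ → ℕ → ℕ
ν p f = sum (map (λ k → p ^ k) (drop 1 (upTo f)))

digitSum : ℕ → ℕ → (ℕ → ℕ) → ℕ
digitSum p f d = sum (map (λ i → d i * p ^ (f ∸ 1 ∸ i)) (upTo f))

IsDigits : ℕ → ℕ → ℕ → (ℕ → ℕ) → Set
IsDigits p f h d =
  (∀ i → i < f → d i ≤ p ∸ 1) ×
  (h ℕ.% suc (q p f) ≡ (1 + digitSum p f d) ℕ.% suc (q p f))

hAux : ℕ → ℕ → (ℕ → ℕ) → ℕ → ℕ
hAux p f d j with j <? f
... | yes _ = d j
... | no  _ = (p ∸ 1) ∸ d (j ∸ f)

hh : ℕ → ℕ → (ℕ → ℕ) → ℤ → ℕ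
hh p f d i = hAux p f d (modℤ i (2 * f))

ε : ℕ → ℕ → (ℕ → ℕ) → ℤ → ℕ
ε p f d i = if hh p f d i ≡ᵇ (p ∸ 1) then 1 else 0

αAux : ℕ → ℕ → ℕ → ℤ → ℕ → ℕ
αAux p f h γ j = modℤ (+ ((p ^ j * h) / suc (q p f)) ℤ.- (+ (p ^ j)) ℤ.* γ) (e p f)

α : ℕ → ℕ → ℕ → ℤ → ℤ → ℕ
α p f h γ i = αAux p f h γ (modℤ i (2 * f))

data Region : Set where
  𝐀 𝐀𝐁 𝐁 𝟎 : Region

-- The thresholds ν/p and (p-1)ν/p are handled by multiplying
-- the defining inequalities through by p > 0:
--   α < ν/p + ε'            ⇔  p α < ν + p ε'
--   α ≤ (p-1)ν/p - ε        ⇔  p α + p ε ≤ (p-1) ν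
--   (p-1)ν/p - ε < α        ⇔  (p-1) ν < p α + p ε
IsX : ℕ → ℕ → ℕ → ℤ → (ℕ → ℕ) → ℤ → Region → Set
IsX p f h γ d i 𝐀  =
  p * α p f h γ i < ν p f + p * ε p f d (i ℤ.+ + f)
IsX p f h γ d i 𝐀𝐁 =
  (ν p f + p * ε p f d (i ℤ.+ + f) ≤ p * α p f h γ i) ×
  (p * α p f h γ i + p * ε p f d i ≤ (p ∸ 1) * ν p f)
IsX p f h γ d i 𝐁  =
  ((p ∸ 1) * ν p f < p * α p f h γ i + p * ε p f d i) ×
  (α p f h γ i ≤ ν p f)
IsX p f h γ d i 𝟎  =
  (ν p f < α p f h γ i) × (α p f h γ i < e p f)

module Submission where

-- Write h = 1 + D + k(q+1) with D = (h_0 … h_{f-1})_p.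
-- 1. For 0 ≤ j ≤ 2f the quotient β_j = ⌊p^j h/(q+1)⌋ equals (h_0 … h_{j-1})_p + p^j k:
--    dividing p^j(1 + D) by q+1 = p^f + 1 keeps the first j digits of D, and the
--    multiplication by q ≡ -1 (mod q+1) replaces D by its complement, whose digits are
--    h_{f+i} = p-1-h_i.  Hence β_{j+1} = p β_j + h_j, and modulo e = q-1 both β and p^j
--    are 2f-periodic.  Consequently α_{i+1} = (p α_i + h_i) mod e for every i ∈ ℤ.
-- 2. h_{i+f} = p-1-h_i, so ε_i and ε_{i+f} are the indicators of h_i = p-1 and h_i = 0.
-- 3. Since e = (p-1)(ν+1) and p ∣ ν, elementary inequalities place p α_i + h_i: from
--    region AB it lies strictly between ν and e (part (i)); from regions A or B its
--    residue modulo e is at most ν (part (ii)).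

open import Defs
open import Data.Nat
  using (ℕ; zero; suc; _+_; _*_; _∸_; _^_; _≤_; _<_; _≤?_; _<?_; _≡ᵇ_; _/_; _%_;
         z≤n; s≤s; NonZero; >-nonZero; >-nonZero⁻¹)
open import Data.Nat.Properties
open import Data.Nat.DivMod
  using (m≡m%n+[m/n]*n; m<n⇒m%n≡m; m≤n⇒[n∸m]%m≡n%m; [m+n]%n≡m%n; n%n≡0;
         m%n<n; +-distrib-/-∣ʳ; m<n⇒m/n≡0; m*n/n≡m)
open import Data.Nat.Divisibility using (_∣_; n∣m*n)
open import Data.Nat.Primality using (Prime; ¬prime[0]; ¬prime[1])
open import Data.Nat.Tactic.RingSolver using (solve-∀)
open import Data.Integer as ℤ using (ℤ; +_; -[1+_])
import Data.Integer.Properties as ℤP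
open import Data.Integer.DivMod using (_/ℕ_; n%ℕd<d; a≡a%ℕn+[a/ℕn]*n)
import Data.Integer.Tactic.RingSolver as ℤSolver
open import Data.List using (applyUpTo)
open import Data.List.Properties using (map-applyUpTo)
open import Data.Nat.ListAction using (sum)
open import Data.Product using (_×_; _,_; proj₁; proj₂)
open import Data.Sum using (_⊎_; inj₁; inj₂)
open import Data.Bool using (true; false; if_then_else_; T)
open import Data.Unit using (tt)
open import Relation.Nullary using (¬_; yes; no; contradiction)
open import Relation.Binary.PropositionalEquality
  using (_≡_; _≢_; refl; sym; trans; cong; cong₂; subst; subst₂; module ≡-Reasoning)

-- Residues of integers modulo n.

modℤ-spec : ∀ x n .{{_ : NonZero n}} →
  modℤ x n < n × x ≡ + modℤ x n ℤ.+ (x /ℕ n) ℤ.* + n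
modℤ-spec x (suc n) = n%ℕd<d x (suc n) , a≡a%ℕn+[a/ℕn]*n x (suc n)

modℤ-nat : ∀ m n .{{_ : NonZero n}} → modℤ (+ m) n ≡ m % n
modℤ-nat m (suc n) = refl

pos-linear : ∀ a y n → + (a + y * n) ≡ + a ℤ.+ + y ℤ.* + n
pos-linear a y n = trans (ℤP.pos-+ a (y * n)) (cong (ℤ._+_ (+ a)) (ℤP.pos-* y n))

pos-affine : ∀ a r b → + (a * r + b) ≡ + a ℤ.* + r ℤ.+ + b
pos-affine a r b = trans (ℤP.pos-+ (a * r) b) (cong (λ y → y ℤ.+ + b) (ℤP.pos-* a r))

positive-shift-≥ : ∀ {n r s} t → + s ≡ + r ℤ.+ + suc t ℤ.* + n → n ≤ s
positive-shift-≥ {n} {r} {s} t eq = subst (n ≤_) (sym s≡) n≤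
  where
  s≡ : s ≡ r + suc t * n
  s≡ = ℤP.+-injective (trans eq (sym (pos-linear r (suc t) n)))
  n≤ : n ≤ r + suc t * n
  n≤ = ≤-trans (m≤m+n n (t * n)) (m≤n+m (suc t * n) r)

solve-for-left : ∀ a b c → a ≡ b ℤ.+ c → b ≡ a ℤ.+ ℤ.- c
solve-for-left _ b c refl = cancel b c
  where
  cancel : ∀ b c → b ≡ (b ℤ.+ c) ℤ.+ ℤ.- c
  cancel = ℤSolver.solve-∀

residue-unique : ∀ {n r s} t → r < n → s < n → + s ≡ + r ℤ.+ t ℤ.* + n → s ≡ r
residue-unique {n} {r} (+ zero) _ _ eq =
  ℤP.+-injective (trans eq (trans (cong (ℤ._+_ (+ r)) (ℤP.*-zeroˡ (+ n))) (ℤP.+-identityʳ (+ r))))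
residue-unique (+ suc t) _ s<n eq = contradiction (positive-shift-≥ t eq) (<⇒≱ s<n)
residue-unique {n} {r} {s} -[1+ t ] r<n _ eq = contradiction (positive-shift-≥ t r≡) (<⇒≱ r<n)
  where
  r≡ : + r ≡ + s ℤ.+ + suc t ℤ.* + n
  r≡ = trans (solve-for-left (+ s) (+ r) (-[1+ t ] ℤ.* + n) eq) (cong (ℤ._+_ (+ s)) (ℤP.neg-distribˡ-* -[1+ t ] (+ n)))

modℤ-unique : ∀ {n r} x c .{{_ : NonZero n}} → r < n → x ≡ + r ℤ.+ c ℤ.* + n → modℤ x n ≡ r
modℤ-unique {n} {r} x c r<n x≡ = residue-unique (c ℤ.- x /ℕ n) r<n s<n s≡
  where
  s = modℤ x n
  s<n = proj₁ (modℤ-spec x n)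
  rearrange : ∀ s r c u n → s ≡ (s ℤ.+ u ℤ.* n) ℤ.- u ℤ.* n
  rearrange = ℤSolver.solve-∀
  regroup : ∀ r c u n → (r ℤ.+ c ℤ.* n) ℤ.- u ℤ.* n ≡ r ℤ.+ (c ℤ.- u) ℤ.* n
  regroup = ℤSolver.solve-∀
  s≡ : + s ≡ + r ℤ.+ (c ℤ.- x /ℕ n) ℤ.* + n
  s≡ = begin
    + s                                      ≡⟨ rearrange (+ s) (+ r) c (x /ℕ n) (+ n) ⟩
    (+ s ℤ.+ x /ℕ n ℤ.* + n) ℤ.- x /ℕ n ℤ.* + n ≡⟨ cong (λ y → y ℤ.- x /ℕ n ℤ.* + n) (trans (sym (proj₂ (modℤ-spec x n))) x≡) ⟩
    (+ r ℤ.+ c ℤ.* + n) ℤ.- x /ℕ n ℤ.* + n   ≡⟨ regroup (+ r) c (x /ℕ n) (+ n) ⟩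
    + r ℤ.+ (c ℤ.- x /ℕ n) ℤ.* + n           ∎
    where open ≡-Reasoning

modℤ-cong : ∀ {n} y z c .{{_ : NonZero n}} → y ≡ z ℤ.+ c ℤ.* + n → modℤ y n ≡ modℤ z n
modℤ-cong {n} y z c y≡ = modℤ-unique y (z /ℕ n ℤ.+ c) (proj₁ (modℤ-spec z n)) (begin
  y                                              ≡⟨ y≡ ⟩
  z ℤ.+ c ℤ.* + n                                ≡⟨ cong (λ y → y ℤ.+ c ℤ.* + n) (proj₂ (modℤ-spec z n)) ⟩
  (+ modℤ z n ℤ.+ z /ℕ n ℤ.* + n) ℤ.+ c ℤ.* + n  ≡⟨ regroup (+ modℤ z n) (z /ℕ n) c (+ n) ⟩
  + modℤ z n ℤ.+ (z /ℕ n ℤ.+ c) ℤ.* + n          ∎)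
  where
  open ≡-Reasoning
  regroup : ∀ r u c n → (r ℤ.+ u ℤ.* n) ℤ.+ c ℤ.* n ≡ r ℤ.+ (u ℤ.+ c) ℤ.* n
  regroup = ℤSolver.solve-∀

modℤ-shift : ∀ i k n .{{_ : NonZero n}} → modℤ (i ℤ.+ + k) n ≡ (k + modℤ i n) % n
modℤ-shift i k n = trans (modℤ-cong (i ℤ.+ + k) (+ (k + modℤ i n)) (i /ℕ n) (begin
  i ℤ.+ + k                                   ≡⟨ cong (λ y → y ℤ.+ + k) (proj₂ (modℤ-spec i n)) ⟩
  (+ modℤ i n ℤ.+ i /ℕ n ℤ.* + n) ℤ.+ + k     ≡⟨ regroup (+ modℤ i n) (i /ℕ n) (+ n) (+ k) ⟩
  (+ k ℤ.+ + modℤ i n) ℤ.+ i /ℕ n ℤ.* + n     ≡⟨ cong (λ y → y ℤ.+ i /ℕ n ℤ.* + n) (sym (ℤP.pos-+ k (modℤ i n))) ⟩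
  + (k + modℤ i n) ℤ.+ i /ℕ n ℤ.* + n         ∎)) (modℤ-nat (k + modℤ i n) n)
  where
  open ≡-Reasoning
  regroup : ∀ r u n k → (r ℤ.+ u ℤ.* n) ℤ.+ k ≡ (k ℤ.+ r) ℤ.+ u ℤ.* n
  regroup = ℤSolver.solve-∀

modℤ-affine : ∀ a b x n .{{_ : NonZero n}} → modℤ (+ a ℤ.* x ℤ.+ + b) n ≡ (a * modℤ x n + b) % n
modℤ-affine a b x n = trans (modℤ-cong (+ a ℤ.* x ℤ.+ + b) (+ (a * modℤ x n + b)) (+ a ℤ.* (x /ℕ n)) (begin
  + a ℤ.* x ℤ.+ + b                                       ≡⟨ cong (λ y → + a ℤ.* y ℤ.+ + b) (proj₂ (modℤ-spec x n)) ⟩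
  + a ℤ.* (+ modℤ x n ℤ.+ x /ℕ n ℤ.* + n) ℤ.+ + b         ≡⟨ regroup (+ a) (+ modℤ x n) (x /ℕ n) (+ n) (+ b) ⟩
  (+ a ℤ.* + modℤ x n ℤ.+ + b) ℤ.+ (+ a ℤ.* (x /ℕ n)) ℤ.* + n ≡⟨ cong (λ y → y ℤ.+ (+ a ℤ.* (x /ℕ n)) ℤ.* + n) (sym (pos-affine a (modℤ x n) b)) ⟩
  + (a * modℤ x n + b) ℤ.+ (+ a ℤ.* (x /ℕ n)) ℤ.* + n       ∎)) (modℤ-nat (a * modℤ x n + b) n)
  where
  open ≡-Reasoning
  regroup : ∀ a r u n b → a ℤ.* (r ℤ.+ u ℤ.* n) ℤ.+ b ≡ (a ℤ.* r ℤ.+ b) ℤ.+ (a ℤ.* u) ℤ.* n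
  regroup = ℤSolver.solve-∀

combine-congruences : ∀ {A B} a b Y Z E (γ : ℤ) → A ≡ a + Y * E → B ≡ b + Z * E →
  + A ℤ.- + B ℤ.* γ ≡ (+ a ℤ.- + b ℤ.* γ) ℤ.+ (+ Y ℤ.- + Z ℤ.* γ) ℤ.* + E
combine-congruences a b Y Z E γ refl refl = begin
  + (a + Y * E) ℤ.- + (b + Z * E) ℤ.* γ
    ≡⟨ cong₂ (λ u v → u ℤ.- v ℤ.* γ) (pos-linear a Y E) (pos-linear b Z E) ⟩
  (+ a ℤ.+ + Y ℤ.* + E) ℤ.- (+ b ℤ.+ + Z ℤ.* + E) ℤ.* γ
    ≡⟨ regroup (+ a) (+ Y) (+ b) (+ Z) (+ E) γ ⟩
  (+ a ℤ.- + b ℤ.* γ) ℤ.+ (+ Y ℤ.- + Z ℤ.* γ) ℤ.* + E ∎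
  where
  open ≡-Reasoning
  regroup : ∀ a y b z e g → (a ℤ.+ y ℤ.* e) ℤ.- (b ℤ.+ z ℤ.* e) ℤ.* g ≡ (a ℤ.- b ℤ.* g) ℤ.+ (y ℤ.- z ℤ.* g) ℤ.* e
  regroup = ℤSolver.solve-∀

-- Base-p numerals, read most significant digit first.

horner : ℕ → (ℕ → ℕ) → ℕ → ℕ
horner p g zero    = 0
horner p g (suc n) = p * horner p g n + g n

horner-cong : ∀ p {g g'} n → (∀ i → i < n → g i ≡ g' i) → horner p g n ≡ horner p g' n
horner-cong p zero    _  = refl
horner-cong p (suc n) eq =
  cong₂ (λ a b → p * a + b) (horner-cong p n (λ i i<n → eq i (m<n⇒m<1+n i<n))) (eq n (n<1+n n))

horner-split : ∀ p g j m → horner p g (j + m) ≡ horner p g j * p ^ m + horner p (λ i → g (j + i)) m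
horner-split p g j zero = begin
  horner p g (j + 0)        ≡⟨ cong (horner p g) (+-identityʳ j) ⟩
  horner p g j              ≡⟨ sym (trans (+-identityʳ _) (*-identityʳ _)) ⟩
  horner p g j * 1 + 0      ∎
  where open ≡-Reasoning
horner-split p g j (suc m) = begin
  horner p g (j + suc m)                 ≡⟨ cong (horner p g) (+-suc j m) ⟩
  p * horner p g (j + m) + g (j + m)     ≡⟨ cong (λ a → p * a + g (j + m)) (horner-split p g j m) ⟩
  p * (A * p ^ m + B) + g (j + m)        ≡⟨ regroup p A (p ^ m) B (g (j + m)) ⟩
  A * (p * p ^ m) + (p * B + g (j + m))  ∎
  where
  open ≡-Reasoning
  A = horner p g j
  B = horner p (λ i → g (j + i)) m
  regroup : ∀ p a x b c → p * (a * x + b) + c ≡ a * (p * x) + (p * b + c)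
  regroup = solve-∀

horner-as-sum : ∀ p n g → sum (applyUpTo (λ i → g i * p ^ (n ∸ suc i)) n) ≡ horner p g n
horner-as-sum p zero    g = refl
horner-as-sum p (suc n) g = begin
  g 0 * p ^ n + sum (applyUpTo (λ i → g (suc i) * p ^ (n ∸ suc i)) n)
    ≡⟨ cong (λ s → g 0 * p ^ n + s) (horner-as-sum p n (λ i → g (suc i))) ⟩
  g 0 * p ^ n + horner p (λ i → g (suc i)) n
    ≡⟨ cong (λ a → (a + g 0) * p ^ n + horner p (λ i → g (suc i)) n) (sym (*-zeroʳ p)) ⟩
  horner p g 1 * p ^ n + horner p (λ i → g (suc i)) n
    ≡⟨ sym (horner-split p g 1 n) ⟩
  horner p g (suc n) ∎
  where open ≡-Reasoning

digitSum-horner : ∀ p f d → digitSum p f d ≡ horner p d f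
digitSum-horner p zero    d = refl
digitSum-horner p (suc n) d =
  trans (cong sum (map-applyUpTo (λ i → i) _ (suc n))) (horner-as-sum p (suc n) d)

horner-complement : ∀ p' g n → (∀ i → i < n → g i ≤ p') →
  horner (suc p') g n + horner (suc p') (λ i → p' ∸ g i) n + 1 ≡ suc p' ^ n
horner-complement p' g zero    _      = refl
horner-complement p' g (suc n) digits = begin
  (p * A + g n) + (p * B + (p' ∸ g n)) + 1   ≡⟨ regroup p' A B (g n) (p' ∸ g n) ⟩
  p * (A + B) + (g n + (p' ∸ g n)) + 1       ≡⟨ cong (λ c → p * (A + B) + c + 1) (m+[n∸m]≡n (digits n (n<1+n n))) ⟩
  p * (A + B) + p' + 1                       ≡⟨ factor p' A B ⟩
  p * (A + B + 1)                            ≡⟨ cong (p *_) (horner-complement p' g n (λ i i<n → digits i (m<n⇒m<1+n i<n))) ⟩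
  p * p ^ n                                  ∎
  where
  open ≡-Reasoning
  p = suc p'
  A = horner p g n
  B = horner p (λ i → p' ∸ g i) n
  regroup : ∀ p' A B x y → (suc p' * A + x) + (suc p' * B + y) + 1 ≡ suc p' * (A + B) + (x + y) + 1
  regroup = solve-∀
  factor : ∀ p' A B → suc p' * (A + B) + p' + 1 ≡ suc p' * (A + B + 1)
  factor = solve-∀

horner-bound : ∀ p' g n → (∀ i → i < n → g i ≤ p') → horner (suc p') g n < suc p' ^ n
horner-bound p' g n digits = begin-strict
  A              <⟨ n<1+n A ⟩
  suc A          ≡⟨ +-comm 1 A ⟩
  A + 1          ≤⟨ +-monoˡ-≤ 1 (m≤m+n A _) ⟩
  A + _ + 1      ≡⟨ horner-complement p' g n digits ⟩
  suc p' ^ n     ∎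
  where
  open ≤-Reasoning
  A = horner (suc p') g n

div-shift : ∀ a c n .{{_ : NonZero n}} → (a + c * n) / n ≡ a / n + c
div-shift a c n = trans (+-distrib-/-∣ʳ a (n∣m*n c)) (cong (_+_ (a / n)) (m*n/n≡m c n))

quotient-unique : ∀ r Q n .{{_ : NonZero n}} → r < n → (r + Q * n) / n ≡ Q
quotient-unique r Q n r<n = trans (div-shift r Q n) (cong (_+ Q) (m<n⇒m/n≡0 r<n))

prefix-quotient : ∀ p' g {n} j → (∀ i → i < n → g i ≤ p') → j ≤ n →
  (suc p' ^ j * (1 + horner (suc p') g n)) / suc (suc p' ^ n) ≡ horner (suc p') g j
prefix-quotient p' g {n} j digits j≤n with n ∸ j | m+[n∸m]≡n j≤n
... | m | refl = trans (cong (_/ suc (p ^ (j + m))) decomposition)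
                       (quotient-unique r A (suc (p ^ (j + m))) r<N)
  where
  p = suc p'
  P = p ^ j
  M = p ^ m
  A = horner p g j
  B = horner p (λ i → g (j + i)) m
  A<P : A < P
  A<P = horner-bound p' g j (λ i i<j → digits i (≤-trans i<j (m≤m+n j m)))
  B<M : B < M
  B<M = horner-bound p' (λ i → g (j + i)) m (λ i i<m → digits (j + i) (+-monoʳ-< j i<m))
  A≤ : A ≤ P * (1 + B)
  A≤ = ≤-trans (<⇒≤ A<P) (m≤m*n P (1 + B))
  r = P * (1 + B) ∸ A
  r<N : r < suc (p ^ (j + m))
  r<N = s≤s (begin
    r            ≤⟨ m∸n≤m _ A ⟩
    P * (1 + B)  ≤⟨ *-monoʳ-≤ P B<M ⟩
    P * M        ≡⟨ sym (^-distribˡ-+-* p j m) ⟩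
    p ^ (j + m)  ∎)
    where open ≤-Reasoning
  split-identity : ∀ P A M B → P * (1 + (A * M + B)) ≡ P * (1 + B) + A * (P * M)
  split-identity = solve-∀
  merge-identity : ∀ r A X → (r + A) + A * X ≡ r + A * suc X
  merge-identity = solve-∀
  decomposition : P * (1 + horner p g (j + m)) ≡ r + A * suc (p ^ (j + m))
  decomposition = begin
    P * (1 + horner p g (j + m))   ≡⟨ cong (λ X → P * (1 + X)) (horner-split p g j m) ⟩
    P * (1 + (A * M + B))          ≡⟨ split-identity P A M B ⟩
    P * (1 + B) + A * (P * M)      ≡⟨ cong (_+ A * (P * M)) (sym (m∸n+n≡m A≤)) ⟩
    (r + A) + A * (P * M)          ≡⟨ merge-identity r A (P * M) ⟩
    r + A * suc (P * M)            ≡⟨ cong (λ X → r + A * suc X) (sym (^-distribˡ-+-* p j m)) ⟩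
    r + A * suc (p ^ (j + m))      ∎
    where open ≡-Reasoning

-- The constants ν = p + … + p^(f-1) and e = p^f - 1.

geometric : ℕ → ℕ → ℕ
geometric p n = sum (applyUpTo (p ^_) n)

sum-scale : ∀ c g n → sum (applyUpTo (λ k → c * g k) n) ≡ c * sum (applyUpTo g n)
sum-scale c g zero    = sym (*-zeroʳ c)
sum-scale c g (suc n) =
  trans (cong (_+_ (c * g 0)) (sum-scale c (λ k → g (suc k)) n)) (sym (*-distribˡ-+ c (g 0) _))

geometric-sum : ∀ p' n → p' * geometric (suc p') n + 1 ≡ suc p' ^ n
geometric-sum p' zero    = cong (_+ 1) (*-zeroʳ p')
geometric-sum p' (suc n) = begin
  p' * (1 + sum (applyUpTo (λ k → p * p ^ k) n)) + 1  ≡⟨ cong (λ s → p' * (1 + s) + 1) (sum-scale p (p ^_) n) ⟩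
  p' * (1 + p * geometric p n) + 1                   ≡⟨ factor p' (geometric p n) ⟩
  p * (p' * geometric p n + 1)                       ≡⟨ cong (p *_) (geometric-sum p' n) ⟩
  p * p ^ n                                          ∎
  where
  open ≡-Reasoning
  p = suc p'
  factor : ∀ p' G → p' * (1 + suc p' * G) + 1 ≡ suc p' * (p' * G + 1)
  factor = solve-∀

ν-closed : ∀ p f' → ν p (suc f') ≡ p * geometric p f'
ν-closed p f' = trans (cong sum (map-applyUpTo suc (p ^_) f')) (sum-scale p (p ^_) f')

e-closed : ∀ p' f' → e (suc p') (suc f') ≡ p' * ν (suc p') (suc f') + p'
e-closed p' f' = begin
  p * p ^ f' ∸ 1                     ≡⟨ cong (λ x → p * x ∸ 1) (sym (geometric-sum p' f')) ⟩
  p * (p' * G + 1) ∸ 1               ≡⟨ cong (_∸ 1) (expand p' G) ⟩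
  (p' * (p * G) + p') + 1 ∸ 1        ≡⟨ m+n∸n≡m _ 1 ⟩
  p' * (p * G) + p'                  ≡⟨ cong (λ x → p' * x + p') (sym (ν-closed p f')) ⟩
  p' * ν p (suc f') + p'             ∎
  where
  open ≡-Reasoning
  p = suc p'
  G = geometric p f'
  expand : ∀ p' G → suc p' * (p' * G + 1) ≡ (p' * (suc p' * G) + p') + 1
  expand = solve-∀

e-nonzero : ∀ p' f' .{{_ : NonZero p'}} → NonZero (e (suc p') (suc f'))
e-nonzero p' f' = >-nonZero (subst (0 <_) (sym (e-closed p' f')) (≤-trans (>-nonZero⁻¹ p') (m≤n+m p' _)))

module QuotientSequence (p' f h : ℕ) (d : ℕ → ℕ) (digits : IsDigits (suc p') f h d) where
  p = suc p'
  N = suc (p ^ f)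
  H : ℕ → ℕ
  H = hAux p f d
  d̄ : ℕ → ℕ
  d̄ i = p' ∸ d i
  D = horner p d f
  D̄ = horner p d̄ f
  k = h / N
  β : ℕ → ℕ
  β j = (p ^ j * h) / N

  d-bound : ∀ i → i < f → d i ≤ p'
  d-bound = proj₁ digits

  H-low : ∀ j → j < f → H j ≡ d j
  H-low j j<f with j <? f
  ... | yes _   = refl
  ... | no j≮f = contradiction j<f j≮f

  H-high : ∀ m → H (f + m) ≡ p' ∸ d m
  H-high m with f + m <? f
  ... | yes f+m<f = contradiction f+m<f (≤⇒≯ (m≤m+n f m))
  ... | no _      = cong (λ i → p' ∸ d i) (m+n∸m≡n f m)

  H-bound : ∀ j → H j ≤ p'
  H-bound j with j <? f
  ... | yes j<f = d-bound j j<f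
  ... | no _    = m∸n≤m p' (d (j ∸ f))

  complement : D + D̄ + 1 ≡ p ^ f
  complement = horner-complement p' d f d-bound

  e≡D+D̄ : e p f ≡ D + D̄
  e≡D+D̄ = trans (cong (_∸ 1) (sym complement)) (m+n∸n≡m (D + D̄) 1)

  two-f : 2 * f ≡ f + f
  two-f = cong (_+_ f) (+-identityʳ f)

  h-expansion : h ≡ (1 + D) + k * N
  h-expansion = begin
    h              ≡⟨ m≡m%n+[m/n]*n h N ⟩
    h % N + k * N  ≡⟨ cong (_+ k * N) residue ⟩
    1 + D + k * N  ∎
    where
    open ≡-Reasoning
    residue : h % N ≡ 1 + D
    residue = trans (proj₂ digits) (trans (cong (λ x → (1 + x) % N) (digitSum-horner p f d))
                                          (m<n⇒m%n≡m (s≤s (horner-bound p' d f d-bound))))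

  scaled-expansion : ∀ P → P * h ≡ P * (1 + D) + (P * k) * N
  scaled-expansion P = trans (cong (P *_) h-expansion) (distribute P (1 + D) k N)
    where
    distribute : ∀ P a k N → P * (a + k * N) ≡ P * a + (P * k) * N
    distribute = solve-∀

  β-low : ∀ j → j ≤ f → β j ≡ horner p H j + p ^ j * k
  β-low j j≤f = begin
    (p ^ j * h) / N                          ≡⟨ cong (_/ N) (scaled-expansion (p ^ j)) ⟩
    (p ^ j * (1 + D) + (p ^ j * k) * N) / N  ≡⟨ div-shift (p ^ j * (1 + D)) (p ^ j * k) N ⟩
    (p ^ j * (1 + D)) / N + p ^ j * k        ≡⟨ cong (_+ p ^ j * k) (prefix-quotient p' d j d-bound j≤f) ⟩
    horner p d j + p ^ j * k                 ≡⟨ cong (_+ p ^ j * k) (horner-cong p j (λ i i<j → sym (H-low i (<-≤-trans i<j j≤f)))) ⟩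
    horner p H j + p ^ j * k                 ∎
    where open ≡-Reasoning

  horner-H-high : ∀ m → horner p H (f + m) ≡ D * p ^ m + horner p d̄ m
  horner-H-high m = trans (horner-split p H f m)
    (cong₂ (λ a b → a * p ^ m + b) (horner-cong p f H-low) (horner-cong p m (λ i _ → H-high i)))

  -- Multiplying by q ≡ -1 (mod q+1) complements the digits: q(1+D) = (1+D̄) + D(q+1).
  complement-shift : p ^ f * (1 + D) ≡ (1 + D̄) + D * N
  complement-shift = begin
    p ^ f * (1 + D)                          ≡⟨ cong (_* (1 + D)) (sym complement) ⟩
    (D + D̄ + 1) * (1 + D)                   ≡⟨ identity D D̄ ⟩
    (1 + D̄) + D * suc (D + D̄ + 1)           ≡⟨ cong (λ q → (1 + D̄) + D * suc q) complement ⟩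
    (1 + D̄) + D * N                         ∎
    where
    open ≡-Reasoning
    identity : ∀ D D̄ → (D + D̄ + 1) * (1 + D) ≡ (1 + D̄) + D * suc (D + D̄ + 1)
    identity = solve-∀

  β-high : ∀ m → m ≤ f → β (f + m) ≡ horner p H (f + m) + p ^ (f + m) * k
  β-high m m≤f = begin
    (p ^ (f + m) * h) / N                  ≡⟨ cong (_/ N) expansion ⟩
    (P * (1 + D̄) + (P * D + K) * N) / N   ≡⟨ div-shift (P * (1 + D̄)) (P * D + K) N ⟩
    (P * (1 + D̄)) / N + (P * D + K)       ≡⟨ cong (_+ (P * D + K)) (prefix-quotient p' d̄ m (λ i _ → m∸n≤m p' (d i)) m≤f) ⟩
    horner p d̄ m + (P * D + K)            ≡⟨ rearrange (horner p d̄ m) P D K ⟩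
    (D * P + horner p d̄ m) + K            ≡⟨ cong (_+ K) (sym (horner-H-high m)) ⟩
    horner p H (f + m) + K                 ∎
    where
    open ≡-Reasoning
    P = p ^ m
    K = p ^ (f + m) * k
    rearrange : ∀ A P D K → A + (P * D + K) ≡ (D * P + A) + K
    rearrange = solve-∀
    regroup : ∀ Q P X K N → Q * P * X + K * N ≡ P * (Q * X) + K * N
    regroup = solve-∀
    distribute : ∀ P a D K N → P * (a + D * N) + K * N ≡ P * a + (P * D + K) * N
    distribute = solve-∀
    expansion : p ^ (f + m) * h ≡ P * (1 + D̄) + (P * D + K) * N
    expansion = begin
      p ^ (f + m) * h                                ≡⟨ scaled-expansion (p ^ (f + m)) ⟩
      p ^ (f + m) * (1 + D) + K * N                  ≡⟨ cong (λ x → x * (1 + D) + K * N) (^-distribˡ-+-* p f m) ⟩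
      p ^ f * P * (1 + D) + K * N                    ≡⟨ regroup (p ^ f) P (1 + D) K N ⟩
      P * (p ^ f * (1 + D)) + K * N                  ≡⟨ cong (λ x → P * x + K * N) complement-shift ⟩
      P * ((1 + D̄) + D * N) + K * N                 ≡⟨ distribute P (1 + D̄) D K N ⟩
      P * (1 + D̄) + (P * D + K) * N                 ∎

  β-closed : ∀ j → j ≤ 2 * f → β j ≡ horner p H j + p ^ j * k
  β-closed j j≤2f with j ≤? f
  ... | yes j≤f = β-low j j≤f
  ... | no j≰f with j ∸ f | m+[n∸m]≡n (<⇒≤ (≰⇒> j≰f))
  ...   | m | refl = β-high m (+-cancelˡ-≤ f m f (subst (f + m ≤_) two-f j≤2f))

  β-step : ∀ j → j < 2 * f → β (suc j) ≡ p * β j + H j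
  β-step j j<2f = begin
    β (suc j)                                  ≡⟨ β-closed (suc j) j<2f ⟩
    (p * horner p H j + H j) + p * p ^ j * k   ≡⟨ regroup p (horner p H j) (H j) (p ^ j) k ⟩
    p * (horner p H j + p ^ j * k) + H j       ≡⟨ cong (λ b → p * b + H j) (sym (β-closed j (<⇒≤ j<2f))) ⟩
    p * β j + H j                              ∎
    where
    open ≡-Reasoning
    regroup : ∀ p A c P k → (p * A + c) + p * P * k ≡ p * (A + P * k) + c
    regroup = solve-∀

  β-zero : β 0 ≡ k
  β-zero = trans (β-closed 0 z≤n) (+-identityʳ k)

  β-period : β (2 * f) ≡ β 0 + (D + 1 + (D + D̄ + 2) * k) * e p f
  β-period = begin
    β (2 * f)                                          ≡⟨ cong β two-f ⟩
    β (f + f)                                          ≡⟨ β-high f ≤-refl ⟩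
    horner p H (f + f) + p ^ (f + f) * k               ≡⟨ cong₂ (λ a b → a + b * k) (horner-H-high f) (^-distribˡ-+-* p f f) ⟩
    D * p ^ f + D̄ + p ^ f * p ^ f * k                 ≡⟨ cong (λ q → D * q + D̄ + q * q * k) (sym complement) ⟩
    D * Q + D̄ + Q * Q * k                             ≡⟨ identity D D̄ k ⟩
    k + (D + 1 + (D + D̄ + 2) * k) * (D + D̄)          ≡⟨ cong₂ (λ a b → a + (D + 1 + (D + D̄ + 2) * k) * b) (sym β-zero) (sym e≡D+D̄) ⟩
    β 0 + (D + 1 + (D + D̄ + 2) * k) * e p f           ∎
    where
    open ≡-Reasoning
    Q = D + D̄ + 1
    identity : ∀ D D̄ k → D * (D + D̄ + 1) + D̄ + (D + D̄ + 1) * (D + D̄ + 1) * k ≡ k + (D + 1 + (D + D̄ + 2) * k) * (D + D̄)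
    identity = solve-∀

  power-period : p ^ (2 * f) ≡ p ^ 0 + (D + D̄ + 2) * e p f
  power-period = begin
    p ^ (2 * f)                    ≡⟨ trans (cong (p ^_) two-f) (^-distribˡ-+-* p f f) ⟩
    p ^ f * p ^ f                  ≡⟨ cong (λ q → q * q) (sym complement) ⟩
    (D + D̄ + 1) * (D + D̄ + 1)     ≡⟨ identity D D̄ ⟩
    1 + (D + D̄ + 2) * (D + D̄)     ≡⟨ cong (λ b → 1 + (D + D̄ + 2) * b) (sym e≡D+D̄) ⟩
    1 + (D + D̄ + 2) * e p f        ∎
    where
    open ≡-Reasoning
    identity : ∀ D D̄ → (D + D̄ + 1) * (D + D̄ + 1) ≡ 1 + (D + D̄ + 2) * (D + D̄)
    identity = solve-∀

  x : ℤ → ℕ → ℤ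
  x γ j = + β j ℤ.- + (p ^ j) ℤ.* γ

  x-step : ∀ γ j → j < 2 * f → x γ (suc j) ≡ + p ℤ.* x γ j ℤ.+ + H j
  x-step γ j j<2f = begin
    + β (suc j) ℤ.- + (p * p ^ j) ℤ.* γ
      ≡⟨ cong₂ (λ b P → b ℤ.- P ℤ.* γ) (trans (cong +_ (β-step j j<2f)) (pos-affine p (β j) (H j))) (ℤP.pos-* p (p ^ j)) ⟩
    (+ p ℤ.* + β j ℤ.+ + H j) ℤ.- (+ p ℤ.* + (p ^ j)) ℤ.* γ
      ≡⟨ regroup (+ p) (+ β j) (+ H j) (+ (p ^ j)) γ ⟩
    + p ℤ.* x γ j ℤ.+ + H j ∎
    where
    open ≡-Reasoning
    regroup : ∀ p b c P g → (p ℤ.* b ℤ.+ c) ℤ.- (p ℤ.* P) ℤ.* g ≡ p ℤ.* (b ℤ.- P ℤ.* g) ℤ.+ c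
    regroup = ℤSolver.solve-∀

  period-cofactor : ℤ → ℤ
  period-cofactor γ = + (D + 1 + (D + D̄ + 2) * k) ℤ.- + (D + D̄ + 2) ℤ.* γ

  x-period : ∀ γ → x γ (2 * f) ≡ x γ 0 ℤ.+ period-cofactor γ ℤ.* + e p f
  x-period γ = combine-congruences (β 0) (p ^ 0) (D + 1 + (D + D̄ + 2) * k) (D + D̄ + 2) (e p f) γ β-period power-period

𝟙[_≡_] : ℕ → ℕ → ℕ
𝟙[ a ≡ b ] = if a ≡ᵇ b then 1 else 0

indicator-cases : ∀ a b → (a ≡ b × 𝟙[ a ≡ b ] ≡ 1) ⊎ (a ≢ b × 𝟙[ a ≡ b ] ≡ 0)
indicator-cases a b with a ≡ᵇ b in eq
... | true  = inj₁ (≡ᵇ⇒≡ a b (subst T (sym eq) tt) , refl)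
... | false = inj₂ ((λ a≡b → subst T eq (≡⇒≡ᵇ a b a≡b)) , refl)

top-indicator : ∀ p' c → c ≤ p' →
  c + 1 ≤ p' + suc p' * 𝟙[ c ≡ p' ] × suc p' * 𝟙[ c ≡ p' ] ≤ c + 1
top-indicator p' c c≤p' with indicator-cases c p'
... | inj₁ (refl , is-one) rewrite is-one =
  +-monoʳ-≤ p' (s≤s z≤n) , ≤-reflexive (trans (*-identityʳ (suc p')) (+-comm 1 p'))
... | inj₂ (c≢p' , is-zero) rewrite is-zero | *-zeroʳ p' | +-identityʳ p' =
  subst (_≤ p') (+-comm 1 c) (≤∧≢⇒< c≤p' c≢p') , z≤n

m∸n≡m⇒n≡0 : ∀ {m n} → n ≤ m → m ∸ n ≡ m → n ≡ 0
m∸n≡m⇒n≡0 {m} n≤m eq = trans (sym (m∸[m∸n]≡n n≤m)) (trans (cong (m ∸_) eq) (n∸n≡0 m))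

bottom-indicator : ∀ p' c → c ≤ p' →
  1 ≤ c + suc p' * 𝟙[ p' ∸ c ≡ p' ] × c + suc p' * 𝟙[ p' ∸ c ≡ p' ] ≤ suc p'
bottom-indicator p' c c≤p' with indicator-cases (p' ∸ c) p'
... | inj₁ (p'∸c≡p' , is-one) rewrite is-one | m∸n≡m⇒n≡0 c≤p' p'∸c≡p' =
  s≤s z≤n , ≤-reflexive (*-identityʳ (suc p'))
... | inj₂ (p'∸c≢p' , is-zero) rewrite is-zero | *-zeroʳ p' | +-identityʳ c =
  n≢0⇒n>0 (λ c≡0 → p'∸c≢p' (cong (p' ∸_) c≡0)) , m≤n⇒m≤1+n c≤p'

module PeriodicSequences (p' f' h : ℕ) (γ : ℤ) (d : ℕ → ℕ) (digits : IsDigits (suc p') (suc f') h d)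
                         .{{_ : NonZero p'}} where
  f = suc f'
  open QuotientSequence p' f h d digits public

  instance
    e≢0 : NonZero (e p f)
    e≢0 = e-nonzero p' f'

  index-bound : ∀ i → modℤ i (2 * f) < 2 * f
  index-bound i = proj₁ (modℤ-spec i (2 * f))

  α-bound : ∀ i → α p f h γ i < e p f
  α-bound i = proj₁ (modℤ-spec _ (e p f))

  α-index : ∀ j → j ≤ 2 * f → αAux p f h γ (j % (2 * f)) ≡ modℤ (x γ j) (e p f)
  α-index j j≤2f with m≤n⇒m<n∨m≡n j≤2f
  ... | inj₁ j<2f = cong (αAux p f h γ) (m<n⇒m%n≡m j<2f)
  ... | inj₂ refl = trans (cong (αAux p f h γ) (n%n≡0 (2 * f)))
                          (sym (modℤ-cong {e p f} (x γ (2 * f)) (x γ 0) (period-cofactor γ) (x-period γ)))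

  α-step : ∀ j → j < 2 * f → αAux p f h γ ((1 + j) % (2 * f)) ≡ (p * αAux p f h γ j + H j) % e p f
  α-step j j<2f = begin
    αAux p f h γ ((1 + j) % (2 * f))      ≡⟨ α-index (suc j) j<2f ⟩
    modℤ (x γ (suc j)) (e p f)            ≡⟨ cong (λ y → modℤ y (e p f)) (x-step γ j j<2f) ⟩
    modℤ (+ p ℤ.* x γ j ℤ.+ + H j) (e p f) ≡⟨ modℤ-affine p (H j) (x γ j) (e p f) ⟩
    (p * αAux p f h γ j + H j) % e p f    ∎
    where open ≡-Reasoning

  α-succ : ∀ i → α p f h γ (i ℤ.+ + 1) ≡ (p * α p f h γ i + hh p f d i) % e p f
  α-succ i = trans (cong (αAux p f h γ) (modℤ-shift i 1 (2 * f))) (α-step (modℤ i (2 * f)) (index-bound i))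

  H-antipodal : ∀ j → j < 2 * f → H ((f + j) % (2 * f)) ≡ p' ∸ H j
  H-antipodal j j<2f with f ≤? j
  ... | no f≰j = begin
    H ((f + j) % (2 * f))  ≡⟨ cong H (m<n⇒m%n≡m (subst (f + j <_) (sym two-f) (+-monoʳ-< f j<f))) ⟩
    H (f + j)              ≡⟨ H-high j ⟩
    p' ∸ d j               ≡⟨ cong (p' ∸_) (sym (H-low j j<f)) ⟩
    p' ∸ H j               ∎
    where
    open ≡-Reasoning
    j<f = ≰⇒> f≰j
  ... | yes f≤j with j ∸ f | m+[n∸m]≡n f≤j
  ...   | m | refl = begin
    H ((f + (f + m)) % (2 * f))  ≡⟨ cong H wrap ⟩
    H m                          ≡⟨ H-low m m<f ⟩
    d m                          ≡⟨ sym (m∸[m∸n]≡n (d-bound m m<f)) ⟩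
    p' ∸ (p' ∸ d m)              ≡⟨ cong (p' ∸_) (sym (H-high m)) ⟩
    p' ∸ H (f + m)               ∎
    where
    open ≡-Reasoning
    m<f : m < f
    m<f = +-cancelˡ-< f m f (subst (f + m <_) two-f j<2f)
    shift : ∀ f m → f + (f + m) ≡ m + 2 * f
    shift = solve-∀
    wrap : (f + (f + m)) % (2 * f) ≡ m
    wrap = trans (cong (_% (2 * f)) (shift f m))
                 (trans ([m+n]%n≡m%n m (2 * f)) (m<n⇒m%n≡m (<-≤-trans m<f (m≤m+n f _))))

  hh-bound : ∀ i → hh p f d i ≤ p'
  hh-bound i = H-bound (modℤ i (2 * f))

  hh-opposite : ∀ i → hh p f d (i ℤ.+ + f) ≡ p' ∸ hh p f d i
  hh-opposite i = trans (cong H (modℤ-shift i f (2 * f))) (H-antipodal (modℤ i (2 * f)) (index-bound i))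

  top-bounds : ∀ i → hh p f d i + 1 ≤ p' + p * ε p f d i × p * ε p f d i ≤ hh p f d i + 1
  top-bounds i = top-indicator p' (hh p f d i) (hh-bound i)

  bottom-bounds : ∀ i →
    1 ≤ hh p f d i + p * ε p f d (i ℤ.+ + f) × hh p f d i + p * ε p f d (i ℤ.+ + f) ≤ p
  bottom-bounds i = subst (λ t → 1 ≤ c + p * t × c + p * t ≤ p)
    (cong (λ c' → 𝟙[ c' ≡ p' ]) (sym (hh-opposite i))) (bottom-indicator p' c (hh-bound i))
    where c = hh p f d i

module RegionArithmetic (p' ν e : ℕ) .{{_ : NonZero p'}} .{{_ : NonZero e}} (e≡ : e ≡ p' * ν + p') where
  p = suc p'

  AB-successor : ∀ α c ε ε' → 1 ≤ c + p * ε' → c + 1 ≤ p' + p * ε →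
    ν + p * ε' ≤ p * α → p * α + p * ε ≤ p' * ν →
    ν < (p * α + c) % e × (p * α + c) % e < e
  AB-successor α c ε ε' c-low c-high lower upper =
    subst (ν <_) (sym (m<n⇒m%n≡m below)) above , m%n<n (p * α + c) e
    where
    open ≤-Reasoning
    shuffle : ∀ a b c → a + (b + c) ≡ (a + c) + b
    shuffle = solve-∀
    above : ν < p * α + c
    above = begin
      suc ν                 ≡⟨ +-comm 1 ν ⟩
      ν + 1                 ≤⟨ +-monoʳ-≤ ν c-low ⟩
      ν + (c + p * ε')      ≡⟨ shuffle ν c (p * ε') ⟩
      (ν + p * ε') + c      ≤⟨ +-monoˡ-≤ c lower ⟩
      p * α + c             ∎
    below : p * α + c < e
    below = begin
      suc (p * α + c)       ≡⟨ trans (+-comm 1 _) (+-assoc (p * α) c 1) ⟩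
      p * α + (c + 1)       ≤⟨ +-monoʳ-≤ (p * α) c-high ⟩
      p * α + (p' + p * ε)  ≡⟨ shuffle (p * α) p' (p * ε) ⟩
      (p * α + p * ε) + p'  ≤⟨ +-monoˡ-≤ p' upper ⟩
      p' * ν + p'           ≡⟨ sym e≡ ⟩
      e                     ∎

  ν<e : ν < e
  ν<e = begin-strict
    ν            <⟨ n<1+n ν ⟩
    suc ν        ≡⟨ +-comm 1 ν ⟩
    ν + 1        ≤⟨ +-mono-≤ (m≤n*m ν p') (>-nonZero⁻¹ p') ⟩
    p' * ν + p'  ≡⟨ sym e≡ ⟩
    e            ∎
    where open ≤-Reasoning

  residue-small : ∀ x → x ≤ ν → x % e ≤ ν
  residue-small x x≤ν = subst (_≤ ν) (sym (m<n⇒m%n≡m (≤-<-trans x≤ν ν<e))) x≤ν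

  residue-window : ∀ x → e ≤ x → x ≤ e + ν → x % e ≤ ν
  residue-window x e≤x x≤e+ν = subst (_≤ ν) (sym reduce) x∸e≤ν
    where
    x∸e≤ν : x ∸ e ≤ ν
    x∸e≤ν = m≤n+o⇒m∸n≤o x e x≤e+ν
    reduce : x % e ≡ x ∸ e
    reduce = trans (sym (m≤n⇒[n∸m]%m≡n%m e≤x)) (m<n⇒m%n≡m (≤-<-trans x∸e≤ν ν<e))

  module _ (G : ℕ) (ν≡ : ν ≡ p * G) where

    below-A : ∀ α c ε' → p * α < ν + p * ε' → c + p * ε' ≤ p → p * α + c ≤ ν
    below-A α c ε' in-A c-small = +-cancelʳ-≤ (p * ε') (p * α + c) ν (begin
      (p * α + c) + p * ε'    ≡⟨ +-assoc (p * α) c (p * ε') ⟩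
      p * α + (c + p * ε')    ≤⟨ +-monoʳ-≤ (p * α) c-small ⟩
      p * α + p               ≡⟨ trans (+-comm (p * α) p) (sym (*-suc p α)) ⟩
      p * suc α               ≤⟨ *-monoʳ-≤ p α<G+ε' ⟩
      p * (G + ε')            ≡⟨ factor ⟩
      ν + p * ε'              ∎)
      where
      open ≤-Reasoning
      factor : p * (G + ε') ≡ ν + p * ε'
      factor = trans (*-distribˡ-+ p G ε') (cong (_+ p * ε') (sym ν≡))
      α<G+ε' : α < G + ε'
      α<G+ε' = *-cancelˡ-< p α (G + ε') (subst (p * α <_) (sym factor) in-A)

    above-B : ∀ α c ε → p' * ν < p * α + p * ε → p * ε ≤ c + 1 → e ≤ p * α + c
    above-B α c ε in-B c-large = +-cancelʳ-≤ 1 e (p * α + c) (begin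
      e + 1                  ≡⟨ cong (_+ 1) (trans e≡ (cong (λ v → p' * v + p') ν≡)) ⟩
      p' * (p * G) + p' + 1  ≡⟨ factor p' G ⟩
      p * suc (p' * G)       ≤⟨ *-monoʳ-≤ p p'G<α+ε ⟩
      p * (α + ε)            ≡⟨ *-distribˡ-+ p α ε ⟩
      p * α + p * ε          ≤⟨ +-monoʳ-≤ (p * α) c-large ⟩
      p * α + (c + 1)        ≡⟨ sym (+-assoc (p * α) c 1) ⟩
      p * α + c + 1          ∎)
      where
      open ≤-Reasoning
      factor : ∀ p' G → p' * (suc p' * G) + p' + 1 ≡ suc p' * suc (p' * G)
      factor = solve-∀
      commute : ∀ p' G → p' * (suc p' * G) ≡ suc p' * (p' * G)
      commute = solve-∀
      p'G<α+ε : p' * G < α + ε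
      p'G<α+ε = *-cancelˡ-< p (p' * G) (α + ε)
        (subst₂ _<_ (trans (cong (p' *_) ν≡) (commute p' G)) (sym (*-distribˡ-+ p α ε)) in-B)

    within-window : ∀ α c → α ≤ ν → c ≤ p' → p * α + c ≤ e + ν
    within-window α c α≤ν c≤p' = begin
      p * α + c       ≤⟨ +-mono-≤ (*-monoʳ-≤ p α≤ν) c≤p' ⟩
      p * ν + p'      ≡⟨ rearrange p' ν ⟩
      p' * ν + p' + ν ≡⟨ cong (_+ ν) (sym e≡) ⟩
      e + ν           ∎
      where
      open ≤-Reasoning
      rearrange : ∀ p' ν → suc p' * ν + p' ≡ p' * ν + p' + ν
      rearrange = solve-∀

    zero-predecessor : ∀ α c ε ε' → α < e → c ≤ p' → c + p * ε' ≤ p → p * ε ≤ c + 1 →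
      ν < (p * α + c) % e →
      (ν < α × α < e) ⊎ (ν + p * ε' ≤ p * α × p * α + p * ε ≤ p' * ν)
    zero-predecessor α c ε ε' α<e c≤p' c-small c-large next with ν <? α
    ... | yes ν<α = inj₁ (ν<α , α<e)
    ... | no ν≮α with p * α <? ν + p * ε'
    ...   | yes in-A = contradiction (residue-small _ (below-A α c ε' in-A c-small)) (<⇒≱ next)
    ...   | no ¬in-A with p * α + p * ε ≤? p' * ν
    ...     | yes ¬in-B = inj₂ (≮⇒≥ ¬in-A , ¬in-B)
    ...     | no in-B = contradiction
      (residue-window _ (above-B α c ε (≰⇒> in-B) c-large) (within-window α c (≮⇒≥ ν≮α) c≤p'))
      (<⇒≱ next)

lemma2p1p4 : (p f h : ℕ) (γ : ℤ) (d : ℕ → ℕ) →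
    Prime p → 2 ≤ f → h ≤ p ^ (2 * f) ∸ 2 → ¬ (suc (p ^ f) ∣ h) →
    IsDigits p f h d →
    ((i : ℤ) → IsX p f h γ d i 𝐀𝐁 → IsX p f h γ d (i ℤ.+ + 1) 𝟎) ×
    ((i : ℤ) → IsX p f h γ d (i ℤ.+ + 1) 𝟎 → IsX p f h γ d i 𝟎 ⊎ IsX p f h γ d i 𝐀𝐁)
-- The primes 0 and 1 do not exist and f ≥ 1; then both parts combine α-succ with the
-- digit bounds and the region arithmetic.
lemma2p1p4 0 _ _ _ _ p-prime = contradiction p-prime ¬prime[0]
lemma2p1p4 1 _ _ _ _ p-prime = contradiction p-prime ¬prime[1]
lemma2p1p4 (suc p'@(suc _)) zero _ _ _ _ ()
lemma2p1p4 (suc p'@(suc _)) (suc f') h γ d _ _ _ _ digits = AB-then-0 , 0-after-0-or-AB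
  where
  open PeriodicSequences p' f' h γ d digits
  open RegionArithmetic p' (ν p f) (e p f) (e-closed p' f') using (AB-successor; zero-predecessor)

  AB-then-0 : ∀ i → IsX p f h γ d i 𝐀𝐁 → IsX p f h γ d (i ℤ.+ + 1) 𝟎
  AB-then-0 i (lower , upper) = subst (λ a → ν p f < a × a < e p f) (sym (α-succ i))
    (AB-successor (α p f h γ i) (hh p f d i) (ε p f d i) (ε p f d (i ℤ.+ + f))
                  (proj₁ (bottom-bounds i)) (proj₁ (top-bounds i)) lower upper)

  0-after-0-or-AB : ∀ i → IsX p f h γ d (i ℤ.+ + 1) 𝟎 → IsX p f h γ d i 𝟎 ⊎ IsX p f h γ d i 𝐀𝐁
  0-after-0-or-AB i (above , _) =
    zero-predecessor (geometric p f') (ν-closed p f') (α p f h γ i) (hh p f d i) (ε p f d i) (ε p f d (i ℤ.+ + f))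
                     (α-bound i) (hh-bound i) (proj₂ (bottom-bounds i)) (proj₂ (top-bounds i))
                     (subst (ν p f <_) (α-succ i) above)
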